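{- Let $\mathfrak{S}_n$ denote the set of permutations $\pi=(\pi(1),\ldots,\pi(n))$ of $\{1,2,\ldots,n\}$. (i) For any integer $n>5$, there is a permutation $\pi\in \mathfrak{S}_n$ such that $$\sum_{k=1}^{n-1} \frac{1}{\pi(k)-\pi(k+1)}=0.$$ (ii) For any integer $n>7$, there is a permutation $\pi\in \mathfrak{S}_n$ such that $$\sum_{k=1}^{n-1} \frac{1}{\pi(k)-\pi(k+1)} + \frac{1}{\pi(n)-\pi(1)}=0.$$ (iii) For any integer $n>5$, there is a permutation $\pi\in \mathfrak{S}_n$ such that $$\sum_{k=1}^{n-1} \frac{1}{\pi(k)\pi(k+1)}=1.$$ -}

module Defs where

open import Data.Nat using (ℕ; suc)
open import Data.Integer as ℤ using (ℤ; +_; -[1+_]; +[1+_])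
open import Data.Rational as ℚ using (ℚ; _/_; _+_; _*_; 0ℚ)
open import Data.List using (List; []; _∷_; map)
open import Data.Fin using (Fin; toℕ)
open import Data.Fin.Permutation using (Permutation′; _⟨$⟩ʳ_)
open import Data.Vec.Functional using (toList)
open import Data.Fin.Base using ()

-- 𝔖ₙ : permutations of {1,…,n}, represented as bijections of Fin n = {0,…,n-1}.
-- The one-line notation (π(1),…,π(n)) is obtained by shifting by 1.
𝔖 : ℕ → Set
𝔖 n = Permutation′ n

oneLine : ∀ {n} → 𝔖 n → List ℕ
oneLine {n} π = toList (λ (i : Fin n) → suc (toℕ (π ⟨$⟩ʳ i)))

-- reciprocal of an integer as a rational; 1/0 is set to 0 by convention
-- (never used: all denominators below are nonzero for a permutation)
recipℤ : ℤ → ℚ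
recipℤ (+ 0)      = 0ℚ
recipℤ +[1+ m ]   = (+ 1) / suc m
recipℤ -[1+ m ]   = ℤ.- (+ 1) / suc m

recipℕ : ℕ → ℚ
recipℕ n = recipℤ (+ n)

consecSum : (ℕ → ℕ → ℚ) → List ℕ → ℚ
consecSum f []             = 0ℚ
consecSum f (x ∷ [])       = 0ℚ
consecSum f (x ∷ y ∷ xs)   = f x y + consecSum f (y ∷ xs)

invDiff : ℕ → ℕ → ℚ
invDiff a b = recipℤ ((+ a) ℤ.- (+ b))

invProd : ℕ → ℕ → ℚ
invProd a b = recipℕ (a Data.Nat.* b)

headOr0 : List ℕ → ℕ
headOr0 []      = 0
headOr0 (x ∷ _) = x

lastOr0 : List ℕ → ℕ
lastOr0 []           = 0
lastOr0 (x ∷ [])     = x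
lastOr0 (x ∷ y ∷ xs) = lastOr0 (y ∷ xs)

S₁ : ∀ {n} → 𝔖 n → ℚ
S₁ π = consecSum invDiff (oneLine π)

S₂ : ∀ {n} → 𝔖 n → ℚ
S₂ π = S₁ π + invDiff (lastOr0 (oneLine π)) (headOr0 (oneLine π))

S₃ : ∀ {n} → 𝔖 n → ℚ
S₃ π = consecSum invProd (oneLine π)

-- Solutions are grown by inserting new maxima at places where the sum does not
-- change.  For (i) and (ii), putting m + 3, m + 2 between adjacent m + 1, m
-- replaces 1/1 by 1/(−2) + 1/1 + 1/2 and creates the adjacent pair m + 3, m + 2
-- of the same shape; so a solution of size n with n, n − 1 adjacent yields one
-- of size n + 2, and two consecutive starting sizes cover everything beyond.
-- For (iii), 1/(ab) = 1/(a(a + b)) + 1/((a + b)b) lets the new maximum a + b go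
-- between adjacent a, b.  Keeping both windows  m + 6, 3, m + 5  and
-- m + 1, 6, m + 4  in a solution of size m + 6, six such insertions reach size
-- m + 12 with both windows reappearing for m + 6.
module Submission where

open import Defs
open import Data.Nat using (ℕ; _>_)
open import Data.Product using (_×_; ∃-syntax)
open import Data.Rational using (0ℚ; 1ℚ)
open import Relation.Binary.PropositionalEquality using (_≡_)

open import Data.Bool using (if_then_else_)
open import Data.Empty using (⊥-elim)
open import Data.Fin using (Fin; zero; suc; toℕ; fromℕ; punchIn)
open import Data.Fin.Permutation using (insert; insert-punchIn; _⟨$⟩ʳ_) renaming (id to idₚ)
open import Data.Fin.Properties using (_≟_; toℕ-fromℕ)
open import Data.Integer as ℤ using (+_)
import Data.Integer.Properties as ℤP
open import Data.List using (List; []; _∷_; _++_; length; map; tabulate)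
open import Data.List.Properties using (++-assoc; ++-monoid; tabulate-cong; length-tabulate)
open import Data.Nat as ℕ using (zero; suc; _+_; _*_; _∸_; _≤_; NonZero)
import Data.Nat.Properties as ℕP
open import Algebra.Properties.CommutativeSemigroup ℕP.+-commutativeSemigroup using (x∙yz≈y∙xz)
open import Data.Nat.Tactic.RingSolver using (solve-∀)
open import Data.Product using (Σ; _,_)
open import Data.Rational as ℚ using (ℚ; toℚᵘ)
open import Data.Rational.Properties using (toℚᵘ-injective; toℚᵘ-fromℚᵘ; toℚᵘ-homo-+; +-identityˡ; +-identityʳ; +-assoc)
open import Data.Rational.Unnormalised as ℚᵘ using (*≡*) renaming (_/_ to _/ᵘ_; _≃_ to _≃ᵘ_)
import Data.Rational.Unnormalised.Properties as ℚᵘP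
open import Function using (_∘_)
open import Relation.Binary.PropositionalEquality using (refl; sym; trans; cong; cong₂; subst; module ≡-Reasoning)
open import Relation.Nullary using (yes; no)
open import Tactic.MonoidSolver using (solve)

-- positions past the end insert at the end
insertAtℕ : ∀ {A : Set} → ℕ → A → List A → List A
insertAtℕ zero    v xs       = v ∷ xs
insertAtℕ (suc q) v []       = v ∷ []
insertAtℕ (suc q) v (x ∷ xs) = x ∷ insertAtℕ q v xs

insertAtℕ-after : ∀ {A : Set} (P : List A) a v Q →
                  insertAtℕ (suc (length P)) v (P ++ a ∷ Q) ≡ P ++ a ∷ v ∷ Q
insertAtℕ-after []      a v Q = refl
insertAtℕ-after (p ∷ P) a v Q = cong (p ∷_) (insertAtℕ-after P a v Q)

clamp : ℕ → (n : ℕ) → Fin (suc n)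
clamp zero    n       = zero
clamp (suc q) zero    = zero
clamp (suc q) (suc n) = suc (clamp q n)

insertAtℕ-clamp : ∀ {A : Set} q n v (xs : List A) → length xs ≡ n →
                  insertAtℕ (toℕ (clamp q n)) v xs ≡ insertAtℕ q v xs
insertAtℕ-clamp zero    n       v xs       _ = refl
insertAtℕ-clamp (suc q) zero    v []       _ = refl
insertAtℕ-clamp (suc q) (suc n) v (x ∷ xs) e =
  cong (x ∷_) (insertAtℕ-clamp q n v xs (ℕP.suc-injective e))

tabulate-punchIn : ∀ {A : Set} {n} (f : Fin (suc n) → A) i →
                   tabulate f ≡ insertAtℕ (toℕ i) (f i) (tabulate (f ∘ punchIn i))
tabulate-punchIn         f zero    = refl
tabulate-punchIn {n = suc n} f (suc i) = cong (f zero ∷_) (tabulate-punchIn (f ∘ suc) i)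

toℕ-punchIn-fromℕ : ∀ {n} (k : Fin n) → toℕ (punchIn (fromℕ n) k) ≡ toℕ k
toℕ-punchIn-fromℕ zero    = refl
toℕ-punchIn-fromℕ (suc k) = cong suc (toℕ-punchIn-fromℕ k)

insert-self : ∀ {m n} (i : Fin (suc m)) (j : Fin (suc n)) π → insert i j π ⟨$⟩ʳ i ≡ j
insert-self i j π with i ≟ i
... | yes _  = refl
... | no i≢i = ⊥-elim (i≢i refl)

insertMax : ∀ {N} (π : 𝔖 N) q →
            Σ (𝔖 (suc N)) λ π′ → oneLine π′ ≡ insertAtℕ q (suc N) (oneLine π)
insertMax {N} π q = π′ , (begin
    oneLine π′                                                  ≡⟨ tabulate-punchIn entry i ⟩
    insertAtℕ (toℕ i) (entry i) (tabulate (entry ∘ punchIn i))  ≡⟨ cong₂ (insertAtℕ (toℕ i)) new-entry old-entries ⟩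
    insertAtℕ (toℕ i) (suc N) (oneLine π)                       ≡⟨ insertAtℕ-clamp q N (suc N) (oneLine π) (length-tabulate _) ⟩
    insertAtℕ q (suc N) (oneLine π)                             ∎)
  where
  open ≡-Reasoning
  i : Fin (suc N)
  i = clamp q N
  π′ : 𝔖 (suc N)
  π′ = insert i (fromℕ N) π
  entry : Fin (suc N) → ℕ
  entry k = suc (toℕ (π′ ⟨$⟩ʳ k))
  new-entry : entry i ≡ suc N
  new-entry = cong suc (trans (cong toℕ (insert-self i (fromℕ N) π)) (toℕ-fromℕ N))
  old-entries : tabulate (entry ∘ punchIn i) ≡ oneLine π
  old-entries = tabulate-cong λ k →
    cong suc (trans (cong toℕ (insert-punchIn i (fromℕ N) π k)) (toℕ-punchIn-fromℕ (π ⟨$⟩ʳ k)))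

insertMaxAfter : ∀ {N} (π : 𝔖 N) P a Q → oneLine π ≡ P ++ a ∷ Q →
                 Σ (𝔖 (suc N)) λ π′ → oneLine π′ ≡ P ++ a ∷ suc N ∷ Q
insertMaxAfter {N} π P a Q e =
  let π′ , e′ = insertMax π (suc (length P))
  in  π′ , trans e′ (trans (cong (insertAtℕ _ (suc N)) e) (insertAtℕ-after P a (suc N) Q))

rankBefore : List ℕ → ℕ → ℕ
rankBefore []       v = 0
rankBefore (x ∷ xs) v =
  if x ℕ.≡ᵇ v then 0 else if x ℕ.<ᵇ v then suc (rankBefore xs v) else rankBefore xs v

-- If ℓ lists each of 1, …, n exactly once, subsequenceUpTo ℓ k is the subsequence
-- of its entries ≤ k; so  subsequenceUpTo ℓ n ≡ ℓ , checked by evaluation,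
-- certifies ℓ as the one-line notation of a permutation.
subsequenceUpTo : List ℕ → ℕ → List ℕ
subsequenceUpTo ℓ zero    = []
subsequenceUpTo ℓ (suc k) = insertAtℕ (rankBefore ℓ (suc k)) (suc k) (subsequenceUpTo ℓ k)

realiseSubsequence : ∀ ℓ k → Σ (𝔖 k) λ π → oneLine π ≡ subsequenceUpTo ℓ k
realiseSubsequence ℓ zero    = idₚ , refl
realiseSubsequence ℓ (suc k) =
  let π  , e  = realiseSubsequence ℓ k
      π′ , e′ = insertMax π (rankBefore ℓ (suc k))
  in  π′ , trans e′ (cong (insertAtℕ _ (suc k)) e)

realise : ∀ n ℓ → subsequenceUpTo ℓ n ≡ ℓ → Σ (𝔖 n) λ π → oneLine π ≡ ℓ
realise n ℓ h = let π , e = realiseSubsequence ℓ n in π , trans e h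

realiseWith : ∀ (Φ : List ℕ → ℚ) {c} n ℓ → subsequenceUpTo ℓ n ≡ ℓ → Φ ℓ ≡ c →
              Σ (𝔖 n) λ π → Φ (oneLine π) ≡ c
realiseWith Φ n ℓ h v = let π , e = realise n ℓ h in π , trans (cong Φ e) v

consecSum-++ : ∀ f (P : List ℕ) a Q →
               consecSum f (P ++ a ∷ Q) ≡ consecSum f (P ++ a ∷ []) ℚ.+ consecSum f (a ∷ Q)
consecSum-++ f []          a Q = sym (+-identityˡ _)
consecSum-++ f (p ∷ [])    a Q = cong (ℚ._+ consecSum f (a ∷ Q)) (sym (+-identityʳ (f p a)))
consecSum-++ f (p ∷ q ∷ P) a Q =
  trans (cong (f p q ℚ.+_) (consecSum-++ f (q ∷ P) a Q)) (sym (+-assoc (f p q) _ _))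

consecSum-refine : ∀ f P a B b R → consecSum f (a ∷ B ++ b ∷ []) ≡ f a b →
                   consecSum f (P ++ a ∷ B ++ b ∷ R) ≡ consecSum f (P ++ a ∷ b ∷ R)
consecSum-refine f P a B b R h = begin
  consecSum f (P ++ a ∷ B ++ b ∷ R)                         ≡⟨ consecSum-++ f P a _ ⟩
  prefix ℚ.+ consecSum f (a ∷ B ++ b ∷ R)                   ≡⟨ cong (prefix ℚ.+_) (consecSum-++ f (a ∷ B) b R) ⟩
  prefix ℚ.+ (consecSum f (a ∷ B ++ b ∷ []) ℚ.+ suffix)     ≡⟨ cong (λ x → prefix ℚ.+ (x ℚ.+ suffix)) h ⟩
  prefix ℚ.+ (f a b ℚ.+ suffix)                             ≡⟨ sym (consecSum-++ f P a (b ∷ R)) ⟩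
  consecSum f (P ++ a ∷ b ∷ R)                              ∎
  where
  open ≡-Reasoning
  prefix suffix : ℚ
  prefix = consecSum f (P ++ a ∷ [])
  suffix = consecSum f (b ∷ R)

headOr0-++-∷ : ∀ P (a : ℕ) Q → headOr0 (P ++ a ∷ Q) ≡ headOr0 (P ++ a ∷ [])
headOr0-++-∷ []      a Q = refl
headOr0-++-∷ (p ∷ P) a Q = refl

lastOr0-++-∷ : ∀ P (a : ℕ) Q → lastOr0 (P ++ a ∷ Q) ≡ lastOr0 (a ∷ Q)
lastOr0-++-∷ []          a Q = refl
lastOr0-++-∷ (p ∷ [])    a Q = refl
lastOr0-++-∷ (p ∷ q ∷ P) a Q = lastOr0-++-∷ (q ∷ P) a Q

cyclicSum : List ℕ → ℚ
cyclicSum ℓ = consecSum invDiff ℓ ℚ.+ invDiff (lastOr0 ℓ) (headOr0 ℓ)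

cyclicSum-refine : ∀ P a B b R → consecSum invDiff (a ∷ B ++ b ∷ []) ≡ invDiff a b →
                   cyclicSum (P ++ a ∷ B ++ b ∷ R) ≡ cyclicSum (P ++ a ∷ b ∷ R)
cyclicSum-refine P a B b R h =
  cong₂ ℚ._+_ (consecSum-refine invDiff P a B b R h) (cong₂ invDiff same-last same-head)
  where
  same-last : lastOr0 (P ++ a ∷ B ++ b ∷ R) ≡ lastOr0 (P ++ a ∷ b ∷ R)
  same-last = trans (lastOr0-++-∷ P a _)
                (trans (lastOr0-++-∷ (a ∷ B) b R) (sym (lastOr0-++-∷ P a (b ∷ R))))
  same-head : headOr0 (P ++ a ∷ B ++ b ∷ R) ≡ headOr0 (P ++ a ∷ b ∷ R)
  same-head = trans (headOr0-++-∷ P a _) (sym (headOr0-++-∷ P a _))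

invDiff-+ : ∀ a b m → invDiff (a + m) (b + m) ≡ invDiff a b
invDiff-+ a b m = cong recipℤ (begin
    + (a + m) ℤ.- + (b + m)  ≡⟨ ℤP.m-n≡m⊖n (a + m) (b + m) ⟩
    (a + m) ℤ.⊖ (b + m)      ≡⟨ cong₂ ℤ._⊖_ (ℕP.+-comm a m) (ℕP.+-comm b m) ⟩
    (m + a) ℤ.⊖ (m + b)      ≡⟨ ℤP.+-cancelˡ-⊖ m a b ⟩
    a ℤ.⊖ b                  ≡⟨ sym (ℤP.m-n≡m⊖n a b) ⟩
    + a ℤ.- + b              ∎)
  where open ≡-Reasoning

consecSum-invDiff-map-+ : ∀ m ℓ → consecSum invDiff (map (_+ m) ℓ) ≡ consecSum invDiff ℓ
consecSum-invDiff-map-+ m []          = refl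
consecSum-invDiff-map-+ m (a ∷ [])    = refl
consecSum-invDiff-map-+ m (a ∷ b ∷ ℓ) = cong₂ ℚ._+_ (invDiff-+ a b m) (consecSum-invDiff-map-+ m (b ∷ ℓ))

descent-refinement : ∀ m → consecSum invDiff (suc m ∷ 3 + m ∷ 2 + m ∷ m ∷ []) ≡ invDiff (suc m) m
descent-refinement m = begin
  consecSum invDiff (map (_+ m) (1 ∷ 3 ∷ 2 ∷ 0 ∷ []))  ≡⟨ consecSum-invDiff-map-+ m (1 ∷ 3 ∷ 2 ∷ 0 ∷ []) ⟩
  consecSum invDiff (1 ∷ 3 ∷ 2 ∷ 0 ∷ [])               ≡⟨⟩
  invDiff 1 0                                          ≡⟨ sym (invDiff-+ 1 0 m) ⟩
  invDiff (suc m) m                                    ∎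
  where open ≡-Reasoning

-- Parts (i) and (ii): inserting above a top descent

TopDescent : ∀ {m} → 𝔖 (suc m) → Set
TopDescent {m} π = ∃[ P ] ∃[ R ] oneLine π ≡ P ++ suc m ∷ m ∷ R

insertAboveTopDescent : ∀ {m} (π : 𝔖 (suc m)) P R → oneLine π ≡ P ++ suc m ∷ m ∷ R →
                        Σ (𝔖 (3 + m)) λ π′ → oneLine π′ ≡ P ++ suc m ∷ 3 + m ∷ 2 + m ∷ m ∷ R
insertAboveTopDescent {m} π P R e =
  let π₁ , e₁ = insertMaxAfter π P (suc m) (m ∷ R) e
  in  insertMaxAfter π₁ P (suc m) (2 + m ∷ m ∷ R) e₁

module TopDescentTower
  (Φ : List ℕ → ℚ)
  (Φ-refine : ∀ m P R → Φ (P ++ suc m ∷ 3 + m ∷ 2 + m ∷ m ∷ R) ≡ Φ (P ++ suc m ∷ m ∷ R))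
  where

  Vanishing : ℕ → Set
  Vanishing m = Σ (𝔖 (suc m)) λ π → Φ (oneLine π) ≡ 0ℚ × TopDescent π

  vanishing : ∀ P m R → let ℓ = P ++ suc m ∷ m ∷ R in
              subsequenceUpTo ℓ (suc m) ≡ ℓ → Φ ℓ ≡ 0ℚ → Vanishing m
  vanishing P m R h v = let π , e = realise (suc m) _ h in π , trans (cong Φ e) v , P , R , e

  vanishing-+2 : ∀ {m} → Vanishing m → Vanishing (2 + m)
  vanishing-+2 {m} (π , v , P , R , e) =
    let π′ , e′ = insertAboveTopDescent π P R e
    in  π′ , trans (cong Φ e′) (trans (Φ-refine m P R) (trans (cong Φ (sym e)) v))
           , P ++ suc m ∷ [] , m ∷ R , trans e′ (sym (++-assoc P (suc m ∷ []) _))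

  vanishing-from : ∀ {m} → Vanishing m → Vanishing (suc m) → ∀ k → Vanishing (k + m)
  vanishing-from v₀ v₁ 0             = v₀
  vanishing-from v₀ v₁ 1             = v₁
  vanishing-from v₀ v₁ (suc (suc k)) = vanishing-+2 (vanishing-from v₀ v₁ k)

  solution : ∀ {m} → Vanishing m → ∃[ π ] Φ (oneLine {suc m} π) ≡ 0ℚ
  solution (π , v , _) = π , v

module Linear = TopDescentTower (consecSum invDiff)
  (λ m P R → consecSum-refine invDiff P (suc m) (3 + m ∷ 2 + m ∷ []) m R (descent-refinement m))

module Cyclic = TopDescentTower cyclicSum
  (λ m P R → cyclicSum-refine P (suc m) (3 + m ∷ 2 + m ∷ []) m R (descent-refinement m))

-- Part (iii): splitting 1/(ab) at the new maximum a + b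

recip-≃-+ : ∀ x y z .{{_ : NonZero x}} .{{_ : NonZero y}} .{{_ : NonZero z}} →
            y * z ≡ (z + y) * x → (+ 1) /ᵘ x ≃ᵘ (+ 1) /ᵘ y ℚᵘ.+ (+ 1) /ᵘ z
recip-≃-+ x@(suc _) y@(suc _) z@(suc _) e = *≡* (begin
    + 1 ℤ.* + (y * z)                  ≡⟨ ℤP.*-identityˡ _ ⟩
    + (y * z)                          ≡⟨ cong +_ e ⟩
    + ((z + y) * x)                    ≡⟨ ℤP.pos-* (z + y) x ⟩
    + (z + y) ℤ.* + x                  ≡⟨ cong (ℤ._* + x) (ℤP.pos-+ z y) ⟩
    (+ z ℤ.+ + y) ℤ.* + x              ≡⟨ cong₂ (λ p q → (p ℤ.+ q) ℤ.* + x) (sym (ℤP.*-identityˡ (+ z))) (sym (ℤP.*-identityˡ (+ y))) ⟩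
    (+ 1 ℤ.* + z ℤ.+ + 1 ℤ.* + y) ℤ.* + x ∎)
  where open ≡-Reasoning

toℚᵘ-recipℕ : ∀ n .{{_ : NonZero n}} → toℚᵘ (recipℕ n) ≃ᵘ (+ 1) /ᵘ n
toℚᵘ-recipℕ (suc n) = toℚᵘ-fromℚᵘ ((+ 1) /ᵘ suc n)

invProd-split : ∀ a b .{{_ : NonZero a}} .{{_ : NonZero b}} →
                invProd a b ≡ invProd a (a + b) ℚ.+ invProd (a + b) b
invProd-split a@(suc _) b@(suc _) = toℚᵘ-injective (begin
    toℚᵘ (recipℕ (a * b))                                    ≈⟨ toℚᵘ-recipℕ (a * b) ⟩
    (+ 1) /ᵘ (a * b)                                         ≈⟨ recip-≃-+ (a * b) (a * (a + b)) ((a + b) * b) (identity a b) ⟩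
    (+ 1) /ᵘ (a * (a + b)) ℚᵘ.+ (+ 1) /ᵘ ((a + b) * b)      ≈⟨ ℚᵘP.≃-sym (ℚᵘP.+-cong (toℚᵘ-recipℕ _) (toℚᵘ-recipℕ _)) ⟩
    toℚᵘ (invProd a (a + b)) ℚᵘ.+ toℚᵘ (invProd (a + b) b)   ≈⟨ ℚᵘP.≃-sym (toℚᵘ-homo-+ (invProd a (a + b)) _) ⟩
    toℚᵘ (invProd a (a + b) ℚ.+ invProd (a + b) b)           ∎)
  where
  open ℚᵘP.≃-Reasoning
  identity : ∀ a b → (a * (a + b)) * ((a + b) * b) ≡ ((a + b) * b + a * (a + b)) * (a * b)
  identity = solve-∀

invProd-refinement : ∀ a b v .{{_ : NonZero a}} .{{_ : NonZero b}} → a + b ≡ v →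
                     consecSum invProd (a ∷ v ∷ b ∷ []) ≡ invProd a b
invProd-refinement a b _ refl =
  trans (cong (invProd a (a + b) ℚ.+_) (+-identityʳ _)) (sym (invProd-split a b))

insertSum : ∀ {N} (π : 𝔖 N) X U a b U′ V .{{_ : NonZero a}} .{{_ : NonZero b}} → a + b ≡ suc N →
            oneLine π ≡ X ++ (U ++ a ∷ b ∷ U′) ++ V →
            Σ (𝔖 (suc N)) λ π′ → oneLine π′ ≡ X ++ (U ++ a ∷ suc N ∷ b ∷ U′) ++ V × S₃ π′ ≡ S₃ π
insertSum {N} π X U a b U′ V ab e =
  let π′ , e′ = insertMaxAfter π (X ++ U) a (b ∷ R) e₀
  in  π′ , trans e′ (sym (regroup (a ∷ suc N ∷ b ∷ U′))) , (begin
    consecSum invProd (oneLine π′)                    ≡⟨ cong (consecSum invProd) e′ ⟩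
    consecSum invProd ((X ++ U) ++ a ∷ suc N ∷ b ∷ R) ≡⟨ consecSum-refine invProd (X ++ U) a (suc N ∷ []) b R (invProd-refinement a b (suc N) ab) ⟩
    consecSum invProd ((X ++ U) ++ a ∷ b ∷ R)         ≡⟨ cong (consecSum invProd) (sym e₀) ⟩
    consecSum invProd (oneLine π)                     ∎)
  where
  open ≡-Reasoning
  R : List ℕ
  R = U′ ++ V
  regroup : ∀ M → X ++ (U ++ M) ++ V ≡ (X ++ U) ++ M ++ V
  regroup M = solve (++-monoid ℕ)
  e₀ : oneLine π ≡ (X ++ U) ++ a ∷ b ∷ R
  e₀ = trans e (regroup (a ∷ b ∷ U′))

TwoWindows : List ℕ → List ℕ → List ℕ → Set
TwoWindows ℓ u w = ∃[ X ] ∃[ Y ] ∃[ Z ] ℓ ≡ X ++ u ++ Y ++ w ++ Z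

record Stage (N : ℕ) (u w : List ℕ) : Set where
  constructor stage
  field
    perm    : 𝔖 N
    sum≡1   : S₃ perm ≡ 1ℚ
    windows : TwoWindows (oneLine perm) u w

stage-first : ∀ {N w} U a b U′ .{{_ : NonZero a}} .{{_ : NonZero b}} → a + b ≡ suc N →
              Stage N (U ++ a ∷ b ∷ U′) w → Stage (suc N) (U ++ a ∷ suc N ∷ b ∷ U′) w
stage-first {w = w} U a b U′ ab (stage π one (X , Y , Z , e)) =
  let π′ , e′ , same = insertSum π X U a b U′ (Y ++ w ++ Z) ab e
  in  stage π′ (trans same one) (X , Y , Z , e′)

stage-second : ∀ {N u} W a b W′ .{{_ : NonZero a}} .{{_ : NonZero b}} → a + b ≡ suc N →
               Stage N u (W ++ a ∷ b ∷ W′) → Stage (suc N) u (W ++ a ∷ suc N ∷ b ∷ W′)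
stage-second {N} {u} W a b W′ ab (stage π one (X , Y , Z , e)) =
  let π′ , e′ , same = insertSum π (X ++ u ++ Y) W a b W′ Z ab (trans e (regroup (a ∷ b ∷ W′)))
  in  stage π′ (trans same one) (X , Y , Z , trans e′ (sym (regroup (a ∷ suc N ∷ b ∷ W′))))
  where
  regroup : ∀ M → X ++ u ++ Y ++ (W ++ M) ++ Z ≡ (X ++ u ++ Y) ++ (W ++ M) ++ Z
  regroup M = solve (++-monoid ℕ)

stage-shrink : ∀ {N u w} A B C D → Stage N (A ++ u ++ B) (C ++ w ++ D) → Stage N u w
stage-shrink {u = u} {w} A B C D (stage π one (X , Y , Z , e)) =
  stage π one (X ++ A , B ++ Y ++ C , D ++ Z , trans e regroup)
  where
  regroup : X ++ (A ++ u ++ B) ++ Y ++ (C ++ w ++ D) ++ Z ≡ (X ++ A) ++ u ++ (B ++ Y ++ C) ++ w ++ D ++ Z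
  regroup = solve (++-monoid ℕ)

Seed : ℕ → Set
Seed m = Stage (6 + m) (6 + m ∷ 3 ∷ 5 + m ∷ []) (1 + m ∷ 6 ∷ 4 + m ∷ [])

module _ {m : ℕ} (seed : Seed m) where

  stage₁ : Stage (7 + m) (6 + m ∷ 3 ∷ 5 + m ∷ []) (1 + m ∷ 7 + m ∷ 6 ∷ 4 + m ∷ [])
  stage₁ = stage-second [] (1 + m) 6 (4 + m ∷ []) (cong suc (ℕP.+-comm m 6)) seed

  stage₂ : Stage (8 + m) (6 + m ∷ 3 ∷ 8 + m ∷ 5 + m ∷ []) (1 + m ∷ 7 + m ∷ 6 ∷ 4 + m ∷ [])
  stage₂ = stage-first (6 + m ∷ []) 3 (5 + m) [] refl stage₁

  stage₃ : Stage (9 + m) (6 + m ∷ 9 + m ∷ 3 ∷ 8 + m ∷ 5 + m ∷ []) (1 + m ∷ 7 + m ∷ 6 ∷ 4 + m ∷ [])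
  stage₃ = stage-first [] (6 + m) 3 (8 + m ∷ 5 + m ∷ []) (cong (_+_ 6) (ℕP.+-comm m 3)) stage₂

  stage₄ : Stage (10 + m) (6 + m ∷ 9 + m ∷ 3 ∷ 8 + m ∷ 5 + m ∷ []) (1 + m ∷ 7 + m ∷ 6 ∷ 10 + m ∷ 4 + m ∷ [])
  stage₄ = stage-second (1 + m ∷ 7 + m ∷ []) 6 (4 + m) [] refl stage₃

  stage₅ : Stage (11 + m) (6 + m ∷ 9 + m ∷ 3 ∷ 11 + m ∷ 8 + m ∷ 5 + m ∷ []) (1 + m ∷ 7 + m ∷ 6 ∷ 10 + m ∷ 4 + m ∷ [])
  stage₅ = stage-first (6 + m ∷ 9 + m ∷ []) 3 (8 + m) (5 + m ∷ []) refl stage₄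

  stage₆ : Stage (12 + m) (6 + m ∷ 9 + m ∷ 12 + m ∷ 3 ∷ 11 + m ∷ 8 + m ∷ 5 + m ∷ []) (1 + m ∷ 7 + m ∷ 6 ∷ 10 + m ∷ 4 + m ∷ [])
  stage₆ = stage-first (6 + m ∷ []) (9 + m) 3 (11 + m ∷ 8 + m ∷ 5 + m ∷ []) (cong (_+_ 9) (ℕP.+-comm m 3)) stage₅

  nextSeed : Seed (6 + m)
  nextSeed = stage-shrink (6 + m ∷ 9 + m ∷ []) (8 + m ∷ 5 + m ∷ []) (1 + m ∷ []) (4 + m ∷ []) stage₆

fromThreshold : (P : ℕ → Set) (c : ℕ) → (∀ k → P (k + c)) → ∀ n → c ≤ n → P n
fromThreshold P c h n c≤n = subst P (ℕP.m∸n+n≡m c≤n) (h (n ∸ c))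

Zero₁ Zero₂ One₃ : ℕ → Set
Zero₁ n = ∃[ π ] (S₁ {n} π ≡ 0ℚ)
Zero₂ n = ∃[ π ] (S₂ {n} π ≡ 0ℚ)
One₃  n = ∃[ π ] (S₃ {n} π ≡ 1ℚ)

stage-solution : ∀ {N u w} → Stage N u w → One₃ N
stage-solution (stage π one _) = π , one

fromSeed : ∀ {m} → Seed m → ∀ k → One₃ (k + (6 + m))
fromSeed seed 0 = stage-solution seed
fromSeed seed 1 = stage-solution (stage₁ seed)
fromSeed seed 2 = stage-solution (stage₂ seed)
fromSeed seed 3 = stage-solution (stage₃ seed)
fromSeed seed 4 = stage-solution (stage₄ seed)
fromSeed seed 5 = stage-solution (stage₅ seed)
fromSeed {m} seed (suc (suc (suc (suc (suc (suc k)))))) =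
  subst One₃ (x∙yz≈y∙xz k 6 (6 + m)) (fromSeed (nextSeed seed) k)

linear₈ : Linear.Vanishing 7
linear₈ = Linear.vanishing (1 ∷ 2 ∷ 6 ∷ 5 ∷ 3 ∷ 4 ∷ []) 7 [] refl refl

linear₉ : Linear.Vanishing 8
linear₉ = Linear.vanishing (1 ∷ 2 ∷ 3 ∷ 7 ∷ 5 ∷ []) 8 (6 ∷ 4 ∷ []) refl refl

-- No solution of size 7 has 7 next to 6, so the tower starts from sizes 8 and 9.
zero₁ : ∀ k → Zero₁ (k + 6)
zero₁ 0             = realiseWith (consecSum invDiff) 6 (1 ∷ 3 ∷ 6 ∷ 5 ∷ 2 ∷ 4 ∷ []) refl refl
zero₁ 1             = realiseWith (consecSum invDiff) 7 (1 ∷ 3 ∷ 2 ∷ 4 ∷ 6 ∷ 5 ∷ 7 ∷ []) refl refl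
zero₁ (suc (suc k)) =
  subst Zero₁ (cong suc (ℕP.+-suc k 6)) (Linear.solution (Linear.vanishing-from linear₈ linear₉ k))

cyclic₈ : Cyclic.Vanishing 7
cyclic₈ = Cyclic.vanishing (1 ∷ 2 ∷ 3 ∷ 4 ∷ []) 7 (6 ∷ 5 ∷ []) refl refl

cyclic₉ : Cyclic.Vanishing 8
cyclic₉ = Cyclic.vanishing (1 ∷ 3 ∷ 5 ∷ 7 ∷ []) 8 (4 ∷ 6 ∷ 2 ∷ []) refl refl

zero₂ : ∀ k → Zero₂ (k + 8)
zero₂ k = subst Zero₂ (sym (ℕP.+-suc k 7)) (Cyclic.solution (Cyclic.vanishing-from cyclic₈ cyclic₉ k))

seed₁₂ : Seed 6
seed₁₂ =
  let π , e = realise 12 (12 ∷ 3 ∷ 11 ∷ 8 ∷ 7 ∷ 6 ∷ 10 ∷ 2 ∷ 1 ∷ 4 ∷ 5 ∷ 9 ∷ []) refl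
  in  stage π (cong (consecSum invProd) e) ([] , 8 ∷ [] , 2 ∷ 1 ∷ 4 ∷ 5 ∷ 9 ∷ [] , e)

one₃ : ∀ k → One₃ (k + 6)
one₃ 0 = realiseWith (consecSum invProd) 6 (2 ∷ 1 ∷ 3 ∷ 4 ∷ 5 ∷ 6 ∷ []) refl refl
one₃ 1 = realiseWith (consecSum invProd) 7 (2 ∷ 1 ∷ 3 ∷ 7 ∷ 4 ∷ 5 ∷ 6 ∷ []) refl refl
one₃ 2 = realiseWith (consecSum invProd) 8 (2 ∷ 1 ∷ 3 ∷ 8 ∷ 7 ∷ 6 ∷ 5 ∷ 4 ∷ []) refl refl
one₃ 3 = realiseWith (consecSum invProd) 9 (2 ∷ 1 ∷ 3 ∷ 8 ∷ 7 ∷ 6 ∷ 5 ∷ 9 ∷ 4 ∷ []) refl refl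
one₃ 4 = realiseWith (consecSum invProd) 10 (2 ∷ 1 ∷ 3 ∷ 10 ∷ 6 ∷ 7 ∷ 8 ∷ 5 ∷ 9 ∷ 4 ∷ []) refl refl
one₃ 5 = realiseWith (consecSum invProd) 11 (2 ∷ 1 ∷ 4 ∷ 3 ∷ 5 ∷ 11 ∷ 6 ∷ 7 ∷ 8 ∷ 9 ∷ 10 ∷ []) refl refl
one₃ (suc (suc (suc (suc (suc (suc k)))))) = subst One₃ (x∙yz≈y∙xz k 6 6) (fromSeed seed₁₂ k)

theorem1 : (∀ (n : ℕ) → n > 5 → ∃[ π ] (S₁ {n} π ≡ 0ℚ))
         × (∀ (n : ℕ) → n > 7 → ∃[ π ] (S₂ {n} π ≡ 0ℚ))
         × (∀ (n : ℕ) → n > 5 → ∃[ π ] (S₃ {n} π ≡ 1ℚ))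
theorem1 = fromThreshold Zero₁ 6 zero₁ , fromThreshold Zero₂ 8 zero₂ , fromThreshold One₃ 6 one₃
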